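{- Let $G(\mathbb{V})$ be the non-zero component graph of a vector space $\mathbb{V}$ of dimension $n\ge 3$ over a field with $q\ge 3$ elements. Then $\mathrm{Dist}(G(\mathbb{V}))=(q-1)^n$.
   Context: The non-zero component graph $G(\mathbb{V})$ of a finite-dimensional vector space $\mathbb{V}$ with a fixed basis $\{b_1,\dots,b_n\}$ has as vertex set the non-zero vectors of $\mathbb{V}$, two distinct vertices being adjacent if and only if there is some $b_i$ having non-zero coefficient in the expansions of both vectors with respect to the basis. A labeling $f:V(G)\to\{1,\dots,t\}$ of a graph $G$ is $t$-distinguishing if no non-trivial automorphism $g$ of $G$ preserves the labels (i.e., $f\circ g=f$ implies $g=\mathrm{id}$). The distinguishing number $\mathrm{Dist}(G)$ is the least $t$ such that $G$ has a $t$-distinguishing labeling. -}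

module Defs where

open import Level using (0ℓ)
open import Data.Nat using (ℕ; _≤_)
open import Data.Fin using (Fin)
open import Data.Vec using (Vec; lookup; replicate)
open import Data.Product using (Σ; ∃; ∃-syntax; _×_)
open import Function.Bundles using (_↔_)
open import Relation.Nullary using (¬_)
open import Relation.Binary.PropositionalEquality using (_≡_; _≢_)
open import Algebra.Bundles using (CommutativeRing)

record IsField (R : CommutativeRing 0ℓ 0ℓ) : Set where
  open CommutativeRing R
  field
    1≉0     : ¬ (1# ≈ 0#)
    inverse : ∀ x → ¬ (x ≈ 0#) → ∃[ y ] (x * y ≈ 1#)

-- A finite field with exactly q elements, whose setoid equality is
-- propositional equality (every finite field can be presented this way).
record FiniteField (q : ℕ) : Set₁ where
  field
    cring    : CommutativeRing 0ℓ 0ℓ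
  open CommutativeRing cring public
  field
    isField  : IsField cring
    ≈⇒≡      : ∀ {x y} → x ≈ y → x ≡ y
    card     : Carrier ↔ Fin q

module NonZeroComponentGraph {q : ℕ} (F : FiniteField q) (n : ℕ) where
  open FiniteField F

  -- The vector space V = F^n with the standard basis b_1..b_n; a vector is
  -- given by its coordinate vector.
  V : Set
  V = Vec Carrier n

  zeroV : V
  zeroV = replicate n 0#

  IsVertex : V → Set
  IsVertex v = v ≢ zeroV

  Adj : V → V → Set
  Adj u v = u ≢ v × ∃[ i ] (lookup u i ≢ 0# × lookup v i ≢ 0#)

  -- A graph automorphism of G(V), represented by a function on V whose
  -- restriction to the vertex set is a bijection of the vertex set that
  -- preserves and reflects adjacency (its value at 0 is irrelevant).
  record IsAutomorphism (g : V → V) : Set where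
    field
      vertex     : ∀ v → IsVertex v → IsVertex (g v)
      injective  : ∀ u v → IsVertex u → IsVertex v → g u ≡ g v → u ≡ v
      surjective : ∀ w → IsVertex w → ∃[ v ] (IsVertex v × g v ≡ w)
      adj⇒       : ∀ u v → IsVertex u → IsVertex v → Adj u v → Adj (g u) (g v)
      adj⇐       : ∀ u v → IsVertex u → IsVertex v → Adj (g u) (g v) → Adj u v

  Labeling : ℕ → Set
  Labeling t = V → Fin t

  IsDistinguishing : ∀ {t} → Labeling t → Set
  IsDistinguishing f =
    ∀ g → IsAutomorphism g →
      (∀ v → IsVertex v → f (g v) ≡ f v) →
      ∀ v → IsVertex v → g v ≡ v

  DistinguishingNumber : ℕ → Set
  DistinguishingNumber d =
    (Σ (Labeling d) IsDistinguishing) ×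
    (∀ t → Σ (Labeling t) IsDistinguishing → d ≤ t)

module Submission where

-- Label a vector by its vector of digits, a digit being one of q − 1 symbols such that
-- 0 and one fixed non-zero element c₀ share a symbol and the non-zero elements are
-- otherwise told apart; the digit vectors are encoded in Fin ((q − 1) ^ n).
-- A label-preserving automorphism g fixes each vector allBut j (c₁ off j, 0 at j): the
-- only alternative image, with c₀ at j, has no zero coordinate and is therefore
-- adjacent to every vertex, whereas allBut j is not adjacent to single j (c₁ at j only).
-- Hence g (single j) is again supported at j, so g preserves supports, and a vector is
-- determined by its support together with its digits.
-- Conversely, the (q − 1) ^ n vectors without zero coordinates are adjacent to every
-- other vertex, so transposing two of them is an automorphism: a distinguishing
-- labeling must give them pairwise distinct labels.

open import Defs
open import Data.Nat using (ℕ; _≤_; _^_; _∸_; zero; suc; s≤s)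
open import Data.Fin using (Fin; punchIn; punchOut; funToFin; finToFun)
  renaming (zero to fzero; suc to fsuc)
import Data.Fin as Fin
open import Data.Fin.Properties
  using (inj⇒≟; ¬∀⟶∃¬; punchInᵢ≢i; punchIn-injective; punchOut-cong; punchOut-injective;
         punchOut-punchIn; finToFun-funToFin; funToFin-finToFin; injective⇒≤)
open import Data.Vec using (Vec; lookup; replicate; tabulate; _[_]≔_)
open import Data.Vec.Properties
  using (≡-dec; tabulate∘lookup; tabulate-cong; lookup∘tabulate; lookup-replicate;
         lookup∘update; lookup∘update′)
open import Data.Product using (Σ; ∃-syntax; _,_)
open import Data.Sum using (_⊎_; inj₁; inj₂)
open import Function using (_∘_; Injective)
open import Function.Bundles using (Inverse; Injection)
open import Function.Properties.Inverse using (↔⇒↣)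
open import Relation.Nullary using (¬_; yes; no; contradiction)
open import Relation.Binary.Definitions using (DecidableEquality)
open import Relation.Binary.PropositionalEquality

lookup-extensionality : ∀ {A : Set} {n} (xs ys : Vec A n) →
  (∀ i → lookup xs i ≡ lookup ys i) → xs ≡ ys
lookup-extensionality xs ys eq = begin
  xs                   ≡⟨ tabulate∘lookup xs ⟨
  tabulate (lookup xs) ≡⟨ tabulate-cong eq ⟩
  tabulate (lookup ys) ≡⟨ tabulate∘lookup ys ⟩
  ys                   ∎
  where open ≡-Reasoning

funToFin-cong : ∀ {m n} {f g : Fin m → Fin n} →
  (∀ i → f i ≡ g i) → funToFin f ≡ funToFin g
funToFin-cong {zero}  eq = refl
funToFin-cong {suc m} eq = cong₂ Fin.combine (eq fzero) (funToFin-cong (eq ∘ fsuc))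

finToFun-injective : ∀ {m n} {x y : Fin (m ^ n)} →
  (∀ i → finToFun {m} {n} x i ≡ finToFun y i) → x ≡ y
finToFun-injective {m} {n} {x} {y} eq = begin
  x                               ≡⟨ funToFin-finToFin {n} {m} x ⟨
  funToFin (finToFun {m} {n} x)   ≡⟨ funToFin-cong eq ⟩
  funToFin (finToFun {m} {n} y)   ≡⟨ funToFin-finToFin {n} {m} y ⟩
  y                               ∎
  where open ≡-Reasoning

module Transposition {A : Set} (_≟_ : DecidableEquality A) (a b : A) where

  transpose : A → A
  transpose w with w ≟ a
  ... | yes _ = b
  ... | no _ with w ≟ b
  ...   | yes _ = a
  ...   | no _ = w

  transpose-a : transpose a ≡ b
  transpose-a with a ≟ a
  ... | yes _ = refl
  ... | no a≢a = contradiction refl a≢a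

  transpose-b : transpose b ≡ a
  transpose-b with b ≟ a
  ... | yes b≡a = b≡a
  ... | no _ with b ≟ b
  ...   | yes _ = refl
  ...   | no b≢b = contradiction refl b≢b

  transpose-cases : ∀ w → w ≡ a ⊎ w ≡ b ⊎ transpose w ≡ w
  transpose-cases w with w ≟ a
  ... | yes w≡a = inj₁ w≡a
  ... | no _ with w ≟ b
  ...   | yes w≡b = inj₂ (inj₁ w≡b)
  ...   | no _ = inj₂ (inj₂ refl)

  transpose-involutive : ∀ w → transpose (transpose w) ≡ w
  transpose-involutive w with transpose-cases w
  ... | inj₁ refl          = trans (cong transpose transpose-a) transpose-b
  ... | inj₂ (inj₁ refl)   = trans (cong transpose transpose-b) transpose-a
  ... | inj₂ (inj₂ tw≡w)   = trans (cong transpose tw≡w) tw≡w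

module FieldElements {q} (F : FiniteField q) where
  open FiniteField F using (Carrier; card)

  _≟_ : DecidableEquality Carrier
  _≟_ = inj⇒≟ (↔⇒↣ card)

module NonZeroElements {m} (F : FiniteField (suc m)) where
  open FiniteField F using (Carrier; 0#; card)
  open Inverse card using (to; from; strictlyInverseˡ)

  to-injective : ∀ {x y} → to x ≡ to y → x ≡ y
  to-injective = Injection.injective (↔⇒↣ card)

  nonzero : Fin m → Carrier
  nonzero d = from (punchIn (to 0#) d)

  nonzero-≢0 : ∀ d → nonzero d ≢ 0#
  nonzero-≢0 d eq = punchInᵢ≢i (to 0#) d (trans (sym (strictlyInverseˡ _)) (cong to eq))

  nonzero-injective : Injective _≡_ _≡_ nonzero
  nonzero-injective eq = punchIn-injective (to 0#) _ _
    (trans (sym (strictlyInverseˡ _)) (trans (cong to eq) (strictlyInverseˡ _)))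

module Digits {m} (F : FiniteField (suc (suc m))) where
  open FiniteField F using (Carrier; 0#; card)
  open Inverse card using (to; strictlyInverseˡ)
  open NonZeroElements F public

  -- 0# shares its digit with nonzero fzero; on non-zero elements digit inverts nonzero.
  digit : Carrier → Fin (suc m)
  digit x with to 0# Fin.≟ to x
  ... | yes _ = fzero
  ... | no 0≢x = punchOut 0≢x

  digit-0# : digit 0# ≡ fzero
  digit-0# with to 0# Fin.≟ to 0#
  ... | yes _ = refl
  ... | no 0≢0 = contradiction refl 0≢0

  digit-punchOut : ∀ x (0≢x : to 0# ≢ to x) → digit x ≡ punchOut 0≢x
  digit-punchOut x 0≢x with to 0# Fin.≟ to x
  ... | yes 0≡x = contradiction 0≡x 0≢x
  ... | no _ = punchOut-cong (to 0#) refl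

  digit-nonzero : ∀ d → digit (nonzero d) ≡ d
  digit-nonzero d =
    trans (digit-punchOut (nonzero d) (nonzero-≢0 d ∘ to-injective ∘ sym))
          (trans (punchOut-cong (to 0#) (strictlyInverseˡ _)) (punchOut-punchIn (to 0#)))

  digit-injective : ∀ {x y} → x ≢ 0# → y ≢ 0# → digit x ≡ digit y → x ≡ y
  digit-injective {x} {y} x≢0 y≢0 eq = to-injective (punchOut-injective 0≢x 0≢y (begin
    punchOut 0≢x ≡⟨ digit-punchOut x 0≢x ⟨
    digit x      ≡⟨ eq ⟩
    digit y      ≡⟨ digit-punchOut y 0≢y ⟩
    punchOut 0≢y ∎))
    where
    open ≡-Reasoning
    0≢x = x≢0 ∘ to-injective ∘ sym
    0≢y = y≢0 ∘ to-injective ∘ sym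

module GraphProperties {q} (F : FiniteField q) (n : ℕ) where
  open FiniteField F using (0#)
  open FieldElements F using (_≟_)
  open NonZeroComponentGraph F n

  _≟V_ : DecidableEquality V
  _≟V_ = ≡-dec _≟_

  record Meets (u v : V) : Set where
    constructor meets-at
    field
      index    : Fin n
      nonzeroˡ : lookup u index ≢ 0#
      nonzeroʳ : lookup v index ≢ 0#

  adj⇒meets : ∀ {u v} → Adj u v → Meets u v
  adj⇒meets (_ , i , u≢0 , v≢0) = meets-at i u≢0 v≢0

  meets⇒adj : ∀ {u v} → u ≢ v → Meets u v → Adj u v
  meets⇒adj u≢v (meets-at i u≢0 v≢0) = u≢v , i , u≢0 , v≢0

  meets-sym : ∀ {u v} → Meets u v → Meets v u
  meets-sym (meets-at i u≢0 v≢0) = meets-at i v≢0 u≢0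

  nonzero-coordinate⇒vertex : ∀ {v} i → lookup v i ≢ 0# → IsVertex v
  nonzero-coordinate⇒vertex i v≢0 refl = v≢0 (lookup-replicate i 0#)

  vertex⇒nonzero-coordinate : ∀ {v} → IsVertex v → ∃[ i ] lookup v i ≢ 0#
  vertex⇒nonzero-coordinate {v} v≢0 =
    ¬∀⟶∃¬ n (λ i → lookup v i ≡ 0#) (λ i → lookup v i ≟ 0#) λ v≡0 →
      v≢0 (lookup-extensionality v zeroV (λ i → trans (v≡0 i) (sym (lookup-replicate i 0#))))

  vertex-meets-itself : ∀ {v} → IsVertex v → Meets v v
  vertex-meets-itself v≢0 with vertex⇒nonzero-coordinate v≢0
  ... | i , vᵢ≢0 = meets-at i vᵢ≢0 vᵢ≢0

  ¬meets⇒zero : ∀ {v w} i → ¬ Meets v w → lookup w i ≢ 0# → lookup v i ≡ 0#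
  ¬meets⇒zero {v} i ¬meets wᵢ≢0 with lookup v i ≟ 0#
  ... | yes vᵢ≡0 = vᵢ≡0
  ... | no vᵢ≢0 = contradiction (meets-at i vᵢ≢0 wᵢ≢0) ¬meets

  meets-supported : ∀ {v w i} → (∀ l → lookup w l ≢ 0# → l ≡ i) →
    Meets v w → lookup v i ≢ 0#
  meets-supported supp (meets-at l vₗ≢0 wₗ≢0) with supp l wₗ≢0
  ... | refl = vₗ≢0

  Dominating : V → Set
  Dominating a = ∀ w → IsVertex w → Meets a w

  full⇒dominating : ∀ {a} → (∀ i → lookup a i ≢ 0#) → Dominating a
  full⇒dominating full w w≢0 with vertex⇒nonzero-coordinate w≢0
  ... | i , wᵢ≢0 = meets-at i (full i) wᵢ≢0

  module _ {g : V → V} (aut : IsAutomorphism g) where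
    open IsAutomorphism aut

    meets-preserved : ∀ {x y} → IsVertex x → IsVertex y → Meets x y → Meets (g x) (g y)
    meets-preserved {x} {y} x≢0 y≢0 meets with x ≟V y
    ... | yes refl = vertex-meets-itself (vertex x x≢0)
    ... | no x≢y = adj⇒meets (adj⇒ x y x≢0 y≢0 (meets⇒adj x≢y meets))

    meets-reflected : ∀ {x y} → IsVertex x → IsVertex y → Meets (g x) (g y) → Meets x y
    meets-reflected {x} {y} x≢0 y≢0 meets with x ≟V y
    ... | yes refl = vertex-meets-itself x≢0
    ... | no x≢y =
      adj⇒meets (adj⇐ x y x≢0 y≢0 (meets⇒adj (x≢y ∘ injective x y x≢0 y≢0) meets))

  -- Two dominating vertices have the same closed neighbourhood, so swapping them
  -- is an automorphism.
  module DominatingTransposition {a b : V} (a≢0 : IsVertex a) (b≢0 : IsVertex b)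
                                 (a-dom : Dominating a) (b-dom : Dominating b) where
    open Transposition _≟V_ a b public

    transpose-dominating-or-fixed : ∀ w → Dominating (transpose w) ⊎ transpose w ≡ w
    transpose-dominating-or-fixed w with transpose-cases w
    ... | inj₁ refl        = inj₁ (subst Dominating (sym transpose-a) b-dom)
    ... | inj₂ (inj₁ refl) = inj₁ (subst Dominating (sym transpose-b) a-dom)
    ... | inj₂ (inj₂ tw≡w) = inj₂ tw≡w

    transpose-vertex : ∀ w → IsVertex w → IsVertex (transpose w)
    transpose-vertex w w≢0 with transpose-cases w
    ... | inj₁ refl        = subst IsVertex (sym transpose-a) b≢0
    ... | inj₂ (inj₁ refl) = subst IsVertex (sym transpose-b) a≢0
    ... | inj₂ (inj₂ tw≡w) = subst IsVertex (sym tw≡w) w≢0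

    transpose-meets : ∀ x y → IsVertex x → IsVertex y →
      Meets x y → Meets (transpose x) (transpose y)
    transpose-meets x y x≢0 y≢0 meets
      with transpose-dominating-or-fixed x | transpose-dominating-or-fixed y
    ... | inj₁ tx-dom | _ = tx-dom (transpose y) (transpose-vertex y y≢0)
    ... | inj₂ _ | inj₁ ty-dom = meets-sym (ty-dom (transpose x) (transpose-vertex x x≢0))
    ... | inj₂ tx≡x | inj₂ ty≡y = subst₂ Meets (sym tx≡x) (sym ty≡y) meets

    transpose-injective : ∀ x y → transpose x ≡ transpose y → x ≡ y
    transpose-injective x y eq =
      trans (sym (transpose-involutive x)) (trans (cong transpose eq) (transpose-involutive y))

    transpose-adj : ∀ x y → IsVertex x → IsVertex y →
      Adj x y → Adj (transpose x) (transpose y)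
    transpose-adj x y x≢0 y≢0 adj@(x≢y , _) =
      meets⇒adj (x≢y ∘ transpose-injective x y) (transpose-meets x y x≢0 y≢0 (adj⇒meets adj))

    transpose-automorphism : IsAutomorphism transpose
    transpose-automorphism = record
      { vertex     = transpose-vertex
      ; injective  = λ x y _ _ → transpose-injective x y
      ; surjective = λ w w≢0 → transpose w , transpose-vertex w w≢0 , transpose-involutive w
      ; adj⇒       = transpose-adj
      ; adj⇐       = λ x y x≢0 y≢0 adj →
          subst₂ Adj (transpose-involutive x) (transpose-involutive y)
            (transpose-adj _ _ (transpose-vertex x x≢0) (transpose-vertex y y≢0) adj)
      }

  distinguishing-injective-on-dominating : ∀ {t} {f : Labeling t} → IsDistinguishing f →
    ∀ {a b} → IsVertex a → IsVertex b → Dominating a → Dominating b → f a ≡ f b → a ≡ b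
  distinguishing-injective-on-dominating {f = f} dist {a} {b} a≢0 b≢0 a-dom b-dom fa≡fb =
    trans (sym (dist transpose transpose-automorphism preserves a a≢0)) transpose-a
    where
    open DominatingTransposition a≢0 b≢0 a-dom b-dom
    preserves : ∀ v → IsVertex v → f (transpose v) ≡ f v
    preserves v _ with transpose-cases v
    ... | inj₁ refl        = trans (cong f transpose-a) (sym fa≡fb)
    ... | inj₂ (inj₁ refl) = trans (cong f transpose-b) fa≡fb
    ... | inj₂ (inj₂ tv≡v) = cong f tv≡v

module LowerBound {m} (F : FiniteField (suc m)) (k : ℕ) where
  open FiniteField F using (0#)
  open NonZeroElements F
  open NonZeroComponentGraph F (suc k)
  open GraphProperties F (suc k)

  fullVector : Fin (m ^ suc k) → V
  fullVector d = tabulate (nonzero ∘ finToFun d)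

  lookup-fullVector : ∀ d i → lookup (fullVector d) i ≡ nonzero (finToFun d i)
  lookup-fullVector d = lookup∘tabulate (nonzero ∘ finToFun d)

  fullVector-full : ∀ d i → lookup (fullVector d) i ≢ 0#
  fullVector-full d i eq = nonzero-≢0 _ (trans (sym (lookup-fullVector d i)) eq)

  fullVector-vertex : ∀ d → IsVertex (fullVector d)
  fullVector-vertex d = nonzero-coordinate⇒vertex fzero (fullVector-full d fzero)

  fullVector-injective : Injective _≡_ _≡_ fullVector
  fullVector-injective {d} {d′} eq = finToFun-injective λ i → nonzero-injective (begin
    nonzero (finToFun d i)   ≡⟨ lookup-fullVector d i ⟨
    lookup (fullVector d) i  ≡⟨ cong (λ v → lookup v i) eq ⟩
    lookup (fullVector d′) i ≡⟨ lookup-fullVector d′ i ⟩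
    nonzero (finToFun d′ i)  ∎)
    where open ≡-Reasoning

  distinguishing⇒≤ : ∀ t → Σ (Labeling t) IsDistinguishing → m ^ suc k ≤ t
  distinguishing⇒≤ t (f , dist) = injective⇒≤ {f = f ∘ fullVector} λ {d} {d′} eq →
    fullVector-injective (distinguishing-injective-on-dominating dist
      (fullVector-vertex d) (fullVector-vertex d′) (dominating d) (dominating d′) eq)
    where
    dominating : ∀ d → Dominating (fullVector d)
    dominating d = full⇒dominating {fullVector d} (fullVector-full d)

module UpperBound {r} (F : FiniteField (suc (suc (suc r)))) (k : ℕ) where
  open FiniteField F using (Carrier; 0#)
  open FieldElements F using (_≟_)
  open Digits F
  open NonZeroComponentGraph F (suc (suc k))
  open GraphProperties F (suc (suc k))

  label : Labeling (suc (suc r) ^ suc (suc k))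
  label v = funToFin (digit ∘ lookup v)

  label-digits : ∀ {v w} → label v ≡ label w →
    ∀ i → digit (lookup v i) ≡ digit (lookup w i)
  label-digits {v} {w} eq i = begin
    digit (lookup v i)   ≡⟨ finToFun-funToFin (digit ∘ lookup v) i ⟨
    finToFun (label v) i ≡⟨ cong (λ x → finToFun x i) eq ⟩
    finToFun (label w) i ≡⟨ finToFun-funToFin (digit ∘ lookup w) i ⟩
    digit (lookup w i)   ∎
    where open ≡-Reasoning

  c₀ c₁ : Carrier
  c₀ = nonzero fzero
  c₁ = nonzero (fsuc fzero)

  c₁≢0 : c₁ ≢ 0#
  c₁≢0 = nonzero-≢0 (fsuc fzero)

  digit≡digit-c₁ : ∀ {x} → digit x ≡ digit c₁ → x ≡ c₁
  digit≡digit-c₁ {x} eq with x ≟ 0#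
  ... | yes refl =
    contradiction (trans (sym digit-0#) (trans eq (digit-nonzero (fsuc fzero)))) λ ()
  ... | no x≢0 = digit-injective x≢0 c₁≢0 eq

  digit≡digit-0# : ∀ {x} → digit x ≡ digit 0# → x ≡ 0# ⊎ x ≡ c₀
  digit≡digit-0# {x} eq with x ≟ 0#
  ... | yes x≡0 = inj₁ x≡0
  ... | no x≢0 = inj₂ (digit-injective x≢0 (nonzero-≢0 fzero)
                         (trans eq (trans digit-0# (sym (digit-nonzero fzero)))))

  single allBut : Fin (suc (suc k)) → V
  single j = replicate (suc (suc k)) 0# [ j ]≔ c₁
  allBut j = replicate (suc (suc k)) c₁ [ j ]≔ 0#

  lookup-single-≡ : ∀ j → lookup (single j) j ≡ c₁
  lookup-single-≡ j = lookup∘update j (replicate _ 0#) c₁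

  lookup-single-≢ : ∀ {i j} → i ≢ j → lookup (single j) i ≡ 0#
  lookup-single-≢ {i} i≢j =
    trans (lookup∘update′ i≢j (replicate _ 0#) c₁) (lookup-replicate i 0#)

  lookup-allBut-≡ : ∀ j → lookup (allBut j) j ≡ 0#
  lookup-allBut-≡ j = lookup∘update j (replicate _ c₁) 0#

  lookup-allBut-≢ : ∀ {i j} → i ≢ j → lookup (allBut j) i ≡ c₁
  lookup-allBut-≢ {i} i≢j =
    trans (lookup∘update′ i≢j (replicate _ c₁) 0#) (lookup-replicate i c₁)

  single-vertex : ∀ j → IsVertex (single j)
  single-vertex j = nonzero-coordinate⇒vertex j (c₁≢0 ∘ trans (sym (lookup-single-≡ j)))

  allBut-vertex : ∀ j → IsVertex (allBut j)
  allBut-vertex j = nonzero-coordinate⇒vertex (punchIn j fzero)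
    (c₁≢0 ∘ trans (sym (lookup-allBut-≢ (punchInᵢ≢i j fzero))))

  single-supported : ∀ j l → lookup (single j) l ≢ 0# → l ≡ j
  single-supported j l sₗ≢0 with l Fin.≟ j
  ... | yes l≡j = l≡j
  ... | no l≢j = contradiction (lookup-single-≢ l≢j) sₗ≢0

  allBut-¬meets-single : ∀ j → ¬ Meets (allBut j) (single j)
  allBut-¬meets-single j (meets-at l aₗ≢0 sₗ≢0) with single-supported j l sₗ≢0
  ... | refl = aₗ≢0 (lookup-allBut-≡ l)

  module LabelPreservingAutomorphism {g : V → V} (aut : IsAutomorphism g)
                                     (preserves : ∀ v → IsVertex v → label (g v) ≡ label v) where
    open IsAutomorphism aut

    same-digits : ∀ {v} → IsVertex v → ∀ i → digit (lookup (g v) i) ≡ digit (lookup v i)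
    same-digits {v} v≢0 = label-digits {g v} {v} (preserves v v≢0)

    g-allBut-≢ : ∀ {i j} → i ≢ j → lookup (g (allBut j)) i ≡ c₁
    g-allBut-≢ {i} {j} i≢j = digit≡digit-c₁
      (trans (same-digits (allBut-vertex j) i) (cong digit (lookup-allBut-≢ i≢j)))

    g-allBut-≡ : ∀ j → lookup (g (allBut j)) j ≡ 0#
    g-allBut-≡ j
      with digit≡digit-0# (trans (same-digits (allBut-vertex j) j) (cong digit (lookup-allBut-≡ j)))
    ... | inj₁ gⱼ≡0 = gⱼ≡0
    ... | inj₂ gⱼ≡c₀ = contradiction
      (meets-reflected aut (allBut-vertex j) (single-vertex j)
        (full⇒dominating {g (allBut j)} full (g (single j)) (vertex _ (single-vertex j))))
      (allBut-¬meets-single j)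
      where
      full : ∀ l → lookup (g (allBut j)) l ≢ 0#
      full l with l Fin.≟ j
      ... | yes refl = nonzero-≢0 fzero ∘ trans (sym gⱼ≡c₀)
      ... | no l≢j = c₁≢0 ∘ trans (sym (g-allBut-≢ l≢j))

    fixes-allBut : ∀ j → g (allBut j) ≡ allBut j
    fixes-allBut j = lookup-extensionality _ _ coordinate
      where
      coordinate : ∀ i → lookup (g (allBut j)) i ≡ lookup (allBut j) i
      coordinate i with i Fin.≟ j
      ... | yes refl = trans (g-allBut-≡ i) (sym (lookup-allBut-≡ i))
      ... | no i≢j = trans (g-allBut-≢ i≢j) (sym (lookup-allBut-≢ i≢j))

    g-single-supported : ∀ j l → lookup (g (single j)) l ≢ 0# → l ≡ j
    g-single-supported j l gₗ≢0 with l Fin.≟ j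
    ... | yes l≡j = l≡j
    ... | no l≢j =
      contradiction (¬meets⇒zero l ¬meets (c₁≢0 ∘ trans (sym (lookup-allBut-≢ l≢j)))) gₗ≢0
      where
      ¬meets : ¬ Meets (g (single j)) (allBut j)
      ¬meets meets = allBut-¬meets-single j (meets-sym (meets-reflected aut
        (single-vertex j) (allBut-vertex j) (subst (Meets _) (sym (fixes-allBut j)) meets)))

    g-single-≢0 : ∀ j → lookup (g (single j)) j ≢ 0#
    g-single-≢0 j with vertex⇒nonzero-coordinate (vertex _ (single-vertex j))
    ... | l , gₗ≢0 with g-single-supported j l gₗ≢0
    ...   | refl = gₗ≢0

    nonzero-preserved : ∀ {v} → IsVertex v → ∀ {i} → lookup v i ≢ 0# → lookup (g v) i ≢ 0#
    nonzero-preserved v≢0 {i} vᵢ≢0 = meets-supported (g-single-supported i)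
      (meets-preserved aut v≢0 (single-vertex i)
        (meets-at i vᵢ≢0 (c₁≢0 ∘ trans (sym (lookup-single-≡ i)))))

    nonzero-reflected : ∀ {v} → IsVertex v → ∀ {i} → lookup (g v) i ≢ 0# → lookup v i ≢ 0#
    nonzero-reflected v≢0 {i} gᵢ≢0 = meets-supported (single-supported i)
      (meets-reflected aut v≢0 (single-vertex i) (meets-at i gᵢ≢0 (g-single-≢0 i)))

    fixes : ∀ v → IsVertex v → g v ≡ v
    fixes v v≢0 = lookup-extensionality _ _ coordinate
      where
      coordinate : ∀ i → lookup (g v) i ≡ lookup v i
      coordinate i with lookup v i ≟ 0# | lookup (g v) i ≟ 0#
      ... | yes vᵢ≡0 | yes gᵢ≡0 = trans gᵢ≡0 (sym vᵢ≡0)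
      ... | yes vᵢ≡0 | no gᵢ≢0 = contradiction vᵢ≡0 (nonzero-reflected v≢0 gᵢ≢0)
      ... | no vᵢ≢0 | _ = digit-injective (nonzero-preserved v≢0 vᵢ≢0) vᵢ≢0 (same-digits v≢0 i)

  label-distinguishing : IsDistinguishing label
  label-distinguishing g aut preserves = LabelPreservingAutomorphism.fixes aut preserves

mainTheorem9 : (q n : ℕ) (F : FiniteField q) → 3 ≤ n → 3 ≤ q →
    NonZeroComponentGraph.DistinguishingNumber F n ((q ∸ 1) ^ n)
mainTheorem9 (suc (suc (suc r))) (suc (suc k)) F (s≤s (s≤s (s≤s _))) (s≤s (s≤s (s≤s _))) =
  (label , label-distinguishing) , distinguishing⇒≤
  where
  open UpperBound F k
  open LowerBound F (suc k)
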